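{- Let $k \ge 3$, let $0 \le v < \lvert I_{k-2}\rvert$, and let $0 \le u \le 2^{k-1}-b_k$ be integers. Then $$Z(a_k+v)=Z(a_{k-2}+v)+1,$$ $$Z(b_k+u)=Z(a_{k-1}+u)+1,$$ $$Z(2^k-(b_k+u))=Z(a_{k-1}+u)+1,$$ $$Z(c_k+v)=Z(2^{k-2}-(a_{k-2}+v))+1.$$
   Context: A BSD representation of an integer $n$ is a digit string $(b_{m-1}\cdots b_0)$ with $b_j\in\{1,0,-1\}$ and $n=\sum b_j2^j$; its Hamming weight is the number of nonzero digits. A non-adjacent form (NAF) is a BSD representation in which no two adjacent digits are both nonzero; it is reduced if its leading digit is nonzero. Every positive integer has exactly one reduced NAF; its length is the NAF-bitlength of $n$. $I_k$ denotes the set of positive integers of NAF-bitlength $k$; it is a set of consecutive integers (e.g. $I_1=\{1\}$, $I_2=\{2\}$, $I_3=\{3,4,5\}$), and for $k\ge3$, $\lvert I_k\rvert=2\lvert I_{k-2}\rvert+\lvert I_{k-1}\rvert$. A BSD representation of $n\in I_k$ of length $k$ is optimal if it has the same Hamming weight as the reduced NAF of $n$; $Z(n)$ denotes the number of $0$ digits in an optimal representation of $n$ (equivalently in the reduced NAF of $n$). Write $a_k=\min I_k$ for $k\ge1$ and $a_0=0$ (equivalently $a_1=1,a_2=2$, $a_k=2^{k-2}+a_{k-2}$). For $k\ge3$, $I_k$ is partitioned into consecutive subintervals $\mathcal{A}_k$ (first $\lvert I_{k-2}\rvert$ elements), $\mathcal{B}_k$ (next $\lvert I_{k-1}\rvert$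 elements), $\mathcal{C}_k$ (last $\lvert I_{k-2}\rvert$ elements), with minima $a_k$, $b_k=a_k+\lvert I_{k-2}\rvert$, $c_k=b_k+\lvert I_{k-1}\rvert=2^{k-1}+a_{k-2}$. -}

module Defs where

open import Data.Nat using (ℕ; zero; suc; _+_; _*_; _^_)
open import Data.Integer using (ℤ; +_; -_) renaming (_+_ to _+ℤ_; _*_ to _*ℤ_)
open import Data.List using (List; []; _∷_)
open import Data.Empty using (⊥)
open import Data.Unit using (⊤)
open import Data.Product using (_×_)
open import Relation.Binary.PropositionalEquality using (_≡_)

data Digit : Set where
  one zer neg : Digit

digitVal : Digit → ℤ
digitVal one = + 1
digitVal zer = + 0
digitVal neg = - (+ 1)

-- A BSD representation is a list of digits, LEAST significant digit first:
-- (b₀ ∷ b₁ ∷ … ∷ b_{m-1} ∷ []) represents Σ b_j 2^j.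
value : List Digit → ℤ
value []       = + 0
value (d ∷ ds) = digitVal d +ℤ (+ 2) *ℤ value ds

NonZeroDigit : Digit → Set
NonZeroDigit zer = ⊥
NonZeroDigit _   = ⊤

zeros : List Digit → ℕ
zeros []         = 0
zeros (zer ∷ ds) = suc (zeros ds)
zeros (_   ∷ ds) = zeros ds

NAF : List Digit → Set
NAF []             = ⊤
NAF (d ∷ [])       = ⊤
NAF (d ∷ e ∷ ds)   = (NonZeroDigit d → NonZeroDigit e → ⊥) × NAF (e ∷ ds)

LeadingNonZero : List Digit → Set
LeadingNonZero []           = ⊥
LeadingNonZero (d ∷ [])     = NonZeroDigit d
LeadingNonZero (d ∷ e ∷ ds) = LeadingNonZero (e ∷ ds)

ReducedNAFOf : ℕ → List Digit → Set
ReducedNAFOf n ds = NAF ds × LeadingNonZero ds × value ds ≡ + n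

-- a_k = min I_k : a_0 = 0, a_1 = 1, a_2 = 2, a_k = 2^{k-2} + a_{k-2}
a : ℕ → ℕ
a 0             = 0
a 1             = 1
a 2             = 2
a (suc (suc k)) = 2 ^ k + a k

-- |I_k| : |I_1| = |I_2| = 1, |I_k| = 2|I_{k-2}| + |I_{k-1}|  (k ≥ 3);  |I_0| := 0 (unused)
sizeI : ℕ → ℕ
sizeI 0                   = 0
sizeI 1                   = 1
sizeI 2                   = 1
sizeI (suc (suc (suc k))) = 2 * sizeI (suc k) + sizeI (suc (suc k))

-- b_k = a_k + |I_{k-2}|,  c_k = b_k + |I_{k-1}|   (used for k ≥ 3)
b : ℕ → ℕ
b (suc (suc k)) = a (suc (suc k)) + sizeI k
b _             = 0

c : ℕ → ℕ
c (suc (suc k)) = b (suc (suc k)) + sizeI (suc k)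
c _             = 0

-- "Z x ≡ Z y + 1", where Z n is the number of 0 digits of the (unique) reduced NAF of n
ZSucRel : ℕ → ℕ → Set
ZSucRel x y = ∀ ds es → ReducedNAFOf x ds → ReducedNAFOf y es → zeros ds ≡ suc (zeros es)

{-# OPTIONS --safe #-}

-- For m ≥ 2, every integer of absolute value below a_{m+1} has a NAF of length m (leading zeros
-- allowed): if it is below a_m, pad a NAF of length m − 1 with a zero; otherwise its two top digits
-- are 0 ±1, and subtracting ±2^{m−1} leaves absolute value below a_{m−1}, because
-- a_{m+1} = 2^{m−1} + a_{m−1} and a_{m−1} + a_m = 2^{m−1} + 1.  Consequently each n ∈ I_{L+2} has
-- reduced NAF  w 0 1  (most significant digit last), where w is a NAF of length L of n − 2^{L+1}.
-- With that w (and its negation −w) one writes down the reduced NAFs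
--   2^{L+1} + n = w 0 0 1,   2^{L+2} + n = w 0 −1 0 1,   2^{L+3} − 2^{L+1} − n = −w 0 0 1,
--   2^{L+3} + n = w 0 1 0 1,   2^{L+2} − n = −w 0 1,
-- and each has exactly one zero more than its partner; the four claims are these relations for
-- n = a_{k−2} + v or n = a_{k−1} + u, using b_k = 2^{k−2} + a_{k−1} and c_k = 2^{k−1} + a_{k−2}.
-- Uniqueness of the reduced NAF, which turns explicit representations into values of Z, follows
-- from the parity of the lowest digit, and modulo 4 when it is nonzero.
module Submission where

open import Defs
open import Data.Nat using (ℕ; zero; suc; _+_; _*_; _∸_; _^_; _≤_; _<_; z≤n; s≤s; s≤s⁻¹; _<?_)
open import Data.Nat.Properties
import Data.Nat.Tactic.RingSolver as ℕ-Solver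
open import Data.Integer as ℤ using (ℤ; +_; -[1+_]; _⊖_)
import Data.Integer.Properties as ℤ
import Data.Integer.Tactic.RingSolver as ℤ-Solver
open import Algebra.Properties.AbelianGroup ℤ.+-0-abelianGroup using (∙-cancelˡ)
open import Data.List using (List; []; _∷_; _++_; map; length)
open import Data.List.Properties using (length-map; length-++)
open import Data.Empty using (⊥-elim)
open import Data.Unit using (tt)
open import Data.Product using (_×_; _,_; ∃-syntax; proj₁; proj₂)
import Data.Product as Product
open import Relation.Binary.PropositionalEquality
open import Relation.Nullary using (yes; no)
open import Relation.Binary.Definitions using (tri<; tri≈; tri>)

a-positive : ∀ L → 0 < a (suc L)
a-positive 0             = s≤s z≤n
a-positive 1             = s≤s z≤n
a-positive (suc (suc L)) = ≤-trans (a-positive L) (m≤n+m _ _)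

m+m≡2*m : ∀ m → m + m ≡ 2 * m
m+m≡2*m = ℕ-Solver.solve-∀

a≤2^ : ∀ L → a (suc L) ≤ 2 ^ L
a≤2^ 0             = ≤-refl
a≤2^ 1             = ≤-refl
a≤2^ (suc (suc L)) = begin
  2 ^ suc L + a (suc L) ≤⟨ +-monoʳ-≤ (2 ^ suc L) (≤-trans (a≤2^ L) (m≤m+n (2 ^ L) _)) ⟩
  2 ^ suc L + 2 ^ suc L ≡⟨ m+m≡2*m (2 ^ suc L) ⟩
  2 ^ suc (suc L)       ∎
  where open ≤-Reasoning

a-adjacent : ∀ L → a (suc L) + a (2 + L) ≡ suc (2 ^ suc L)
a-adjacent 0       = refl
a-adjacent (suc L) = begin
  a (2 + L) + (2 ^ suc L + a (suc L)) ≡⟨ rearrange (a (2 + L)) (2 ^ suc L) (a (suc L)) ⟩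
  2 ^ suc L + (a (suc L) + a (2 + L)) ≡⟨ cong (_+_ (2 ^ suc L)) (a-adjacent L) ⟩
  2 ^ suc L + suc (2 ^ suc L)         ≡⟨ +-suc (2 ^ suc L) (2 ^ suc L) ⟩
  suc (2 ^ suc L + 2 ^ suc L)         ≡⟨ cong suc (m+m≡2*m (2 ^ suc L)) ⟩
  suc (2 ^ (2 + L))                   ∎
  where
  open ≡-Reasoning
  rearrange : ∀ x y z → x + (y + z) ≡ y + (z + x)
  rearrange = ℕ-Solver.solve-∀

sizeI+a : ∀ L → sizeI (suc L) + a (suc L) ≡ a (2 + L)
sizeI+a 0             = refl
sizeI+a 1             = refl
sizeI+a (suc (suc L)) = begin
  (2 * s₁ + s₂) + (Q + a₁) ≡⟨ rearrange s₁ s₂ Q a₁ ⟩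
  (s₂ + (s₁ + a₁)) + (s₁ + Q) ≡⟨ cong (λ t → (s₂ + t) + (s₁ + Q)) (sizeI+a L) ⟩
  (s₂ + a (2 + L)) + (s₁ + Q) ≡⟨ cong (λ t → t + (s₁ + Q)) (sizeI+a (suc L)) ⟩
  (Q + a₁) + (s₁ + Q)         ≡⟨ rearrange′ Q a₁ s₁ ⟩
  2 * Q + (s₁ + a₁)           ≡⟨ cong (_+_ (2 * Q)) (sizeI+a L) ⟩
  2 * Q + a (2 + L)           ∎
  where
  open ≡-Reasoning
  s₁ = sizeI (suc L)
  s₂ = sizeI (2 + L)
  a₁ = a (suc L)
  Q  = 2 ^ suc L
  rearrange : ∀ s₁ s₂ Q a₁ → (2 * s₁ + s₂) + (Q + a₁) ≡ (s₂ + (s₁ + a₁)) + (s₁ + Q)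
  rearrange = ℕ-Solver.solve-∀
  rearrange′ : ∀ Q a₁ s₁ → (Q + a₁) + (s₁ + Q) ≡ 2 * Q + (s₁ + a₁)
  rearrange′ = ℕ-Solver.solve-∀

b-closed : ∀ L → b (3 + L) ≡ 2 ^ suc L + a (2 + L)
b-closed L = begin
  (2 ^ suc L + a (suc L)) + sizeI (suc L) ≡⟨ +-assoc (2 ^ suc L) _ _ ⟩
  2 ^ suc L + (a (suc L) + sizeI (suc L)) ≡⟨ cong (_+_ (2 ^ suc L)) (+-comm (a (suc L)) _) ⟩
  2 ^ suc L + (sizeI (suc L) + a (suc L)) ≡⟨ cong (_+_ (2 ^ suc L)) (sizeI+a L) ⟩
  2 ^ suc L + a (2 + L)                   ∎
  where open ≡-Reasoning

c-closed : ∀ L → c (3 + L) ≡ 2 ^ (2 + L) + a (suc L)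
c-closed L = begin
  b (3 + L) + sizeI (2 + L)                   ≡⟨ cong (λ t → t + sizeI (2 + L)) (b-closed L) ⟩
  (2 ^ suc L + a (2 + L)) + sizeI (2 + L)     ≡⟨ +-assoc (2 ^ suc L) _ _ ⟩
  2 ^ suc L + (a (2 + L) + sizeI (2 + L))     ≡⟨ cong (_+_ (2 ^ suc L)) (+-comm (a (2 + L)) _) ⟩
  2 ^ suc L + (sizeI (2 + L) + a (2 + L))     ≡⟨ cong (_+_ (2 ^ suc L)) (sizeI+a (suc L)) ⟩
  2 ^ suc L + (2 ^ suc L + a (suc L))         ≡⟨ +-assoc (2 ^ suc L) _ _ ⟨
  (2 ^ suc L + 2 ^ suc L) + a (suc L)         ≡⟨ cong (λ t → t + a (suc L)) (m+m≡2*m (2 ^ suc L)) ⟩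
  2 ^ (2 + L) + a (suc L)                     ∎
  where open ≡-Reasoning

u≤2^∸b⇒a+u<a : ∀ L u → u ≤ 2 ^ (2 + L) ∸ b (3 + L) → a (2 + L) + u < a (3 + L)
u≤2^∸b⇒a+u<a L u u≤ = begin-strict
  a (2 + L) + u ≤⟨ +-cancelˡ-≤ Q _ _ Q+a+u≤Q+Q ⟩
  Q             <⟨ m<m+n Q (a-positive L) ⟩
  Q + a (suc L) ∎
  where
  open ≤-Reasoning
  Q = 2 ^ suc L
  b≤ : Q + a (2 + L) ≤ 2 ^ (2 + L)
  b≤ = ≤-trans (+-monoʳ-≤ Q (a≤2^ (suc L))) (≤-reflexive (m+m≡2*m Q))
  Q+a+u≤Q+Q : Q + (a (2 + L) + u) ≤ Q + Q
  Q+a+u≤Q+Q = begin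
    Q + (a (2 + L) + u) ≡⟨ rearrange Q (a (2 + L)) u ⟩
    u + (Q + a (2 + L)) ≤⟨ m≤o∸n⇒m+n≤o u b≤ (subst (λ t → u ≤ 2 ^ (2 + L) ∸ t) (b-closed L) u≤) ⟩
    2 ^ (2 + L)         ≡⟨ m+m≡2*m Q ⟨
    Q + Q               ∎
    where
    rearrange : ∀ x y z → x + (y + z) ≡ z + (x + y)
    rearrange = ℕ-Solver.solve-∀

negate : Digit → Digit
negate one = neg
negate zer = zer
negate neg = one

value-negate : ∀ w → value (map negate w) ≡ ℤ.- value w
value-negate []      = refl
value-negate (d ∷ w) = begin
  digitVal (negate d) ℤ.+ + 2 ℤ.* value (map negate w)
    ≡⟨ cong₂ (λ x y → x ℤ.+ + 2 ℤ.* y) (digitVal-negate d) (value-negate w) ⟩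
  ℤ.- digitVal d ℤ.+ + 2 ℤ.* ℤ.- value w
    ≡⟨ distrib (digitVal d) (value w) ⟩
  ℤ.- (digitVal d ℤ.+ + 2 ℤ.* value w) ∎
  where
  open ≡-Reasoning
  digitVal-negate : ∀ d → digitVal (negate d) ≡ ℤ.- digitVal d
  digitVal-negate one = refl
  digitVal-negate zer = refl
  digitVal-negate neg = refl
  distrib : ∀ x y → ℤ.- x ℤ.+ + 2 ℤ.* ℤ.- y ≡ ℤ.- (x ℤ.+ + 2 ℤ.* y)
  distrib = ℤ-Solver.solve-∀

zeros-negate : ∀ w → zeros (map negate w) ≡ zeros w
zeros-negate []        = refl
zeros-negate (zer ∷ w) = cong suc (zeros-negate w)
zeros-negate (one ∷ w) = zeros-negate w
zeros-negate (neg ∷ w) = zeros-negate w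

NAF-negate : ∀ w → NAF w → NAF (map negate w)
NAF-negate []          _            = tt
NAF-negate (d ∷ [])    _            = tt
NAF-negate (d ∷ e ∷ w) (sep , naf) =
  (λ d≠0 e≠0 → sep (nonZero d d≠0) (nonZero e e≠0)) , NAF-negate (e ∷ w) naf
  where
  nonZero : ∀ d → NonZeroDigit (negate d) → NonZeroDigit d
  nonZero one _ = tt
  nonZero neg _ = tt

value-++ : ∀ w s → value (w ++ s) ≡ value w ℤ.+ + 2 ^ length w ℤ.* value s
value-++ []      s = sym (trans (ℤ.+-identityˡ _) (ℤ.*-identityˡ (value s)))
value-++ (d ∷ w) s = begin
  δ ℤ.+ + 2 ℤ.* value (w ++ s)
    ≡⟨ cong (λ t → δ ℤ.+ + 2 ℤ.* t) (value-++ w s) ⟩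
  δ ℤ.+ + 2 ℤ.* (value w ℤ.+ + 2 ^ length w ℤ.* value s)
    ≡⟨ distrib δ (value w) (+ 2 ^ length w) (value s) ⟩
  value (d ∷ w) ℤ.+ (+ 2 ℤ.* + 2 ^ length w) ℤ.* value s
    ≡⟨ cong (λ t → value (d ∷ w) ℤ.+ t ℤ.* value s) (ℤ.pos-* 2 (2 ^ length w)) ⟨
  value (d ∷ w) ℤ.+ + 2 ^ suc (length w) ℤ.* value s ∎
  where
  open ≡-Reasoning
  δ = digitVal d
  distrib : ∀ d x P y → d ℤ.+ + 2 ℤ.* (x ℤ.+ P ℤ.* y) ≡ (d ℤ.+ + 2 ℤ.* x) ℤ.+ (+ 2 ℤ.* P) ℤ.* y
  distrib = ℤ-Solver.solve-∀

zeros-++ : ∀ w s → zeros (w ++ s) ≡ zeros w + zeros s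
zeros-++ []        s = refl
zeros-++ (zer ∷ w) s = cong suc (zeros-++ w s)
zeros-++ (one ∷ w) s = zeros-++ w s
zeros-++ (neg ∷ w) s = zeros-++ w s

NAF-++ : ∀ w s → NAF w → NAF (zer ∷ s) → NAF (w ++ zer ∷ s)
NAF-++ []          s _           naf = naf
NAF-++ (d ∷ [])    s _           naf = (λ _ ()) , naf
NAF-++ (d ∷ e ∷ w) s (sep , naf) nafₛ = sep , NAF-++ (e ∷ w) s naf nafₛ

LeadingNonZero-++ : ∀ w {s} → LeadingNonZero s → LeadingNonZero (w ++ s)
LeadingNonZero-++ []                     lnz = lnz
LeadingNonZero-++ (d ∷ [])    {[]}       ()
LeadingNonZero-++ (d ∷ [])    {e ∷ s}    lnz = lnz
LeadingNonZero-++ (d ∷ e ∷ w)            lnz = LeadingNonZero-++ (e ∷ w) lnz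

-- Uniqueness of the reduced NAF

2*i≢1+2*j : ∀ i j → + 2 ℤ.* i ≢ + 1 ℤ.+ + 2 ℤ.* j
2*i≢1+2*j i j eq = 2*≢1 (i ℤ.- j) (begin
  + 2 ℤ.* (i ℤ.- j)                         ≡⟨ distrib i j ⟩
  + 2 ℤ.* i ℤ.- + 2 ℤ.* j                   ≡⟨ cong (ℤ._- (+ 2 ℤ.* j)) eq ⟩
  (+ 1 ℤ.+ + 2 ℤ.* j) ℤ.- + 2 ℤ.* j         ≡⟨ cancel j ⟩
  + 1                                       ∎)
  where
  open ≡-Reasoning
  2*≢1 : ∀ k → + 2 ℤ.* k ≢ + 1
  2*≢1 (+ 0)           ()
  2*≢1 (+ 1)           ()
  2*≢1 (+ suc (suc n)) ()
  2*≢1 -[1+ n ]        ()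
  distrib : ∀ i j → + 2 ℤ.* (i ℤ.- j) ≡ + 2 ℤ.* i ℤ.- + 2 ℤ.* j
  distrib = ℤ-Solver.solve-∀
  cancel : ∀ j → (+ 1 ℤ.+ + 2 ℤ.* j) ℤ.- + 2 ℤ.* j ≡ + 1
  cancel = ℤ-Solver.solve-∀

nonZero∷-odd : ∀ d → NonZeroDigit d → ∀ ds x → value (d ∷ ds) ≢ + 2 ℤ.* x
nonZero∷-odd one _ ds x eq = 2*i≢1+2*j x (value ds) (sym eq)
nonZero∷-odd neg _ ds x eq =
  2*i≢1+2*j x (value ds ℤ.- + 1) (trans (sym eq) (shift (value ds)))
  where
  shift : ∀ y → ℤ.- + 1 ℤ.+ + 2 ℤ.* y ≡ + 1 ℤ.+ + 2 ℤ.* (y ℤ.- + 1)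
  shift = ℤ-Solver.solve-∀

NAF-tail-even : ∀ {d ds} → NonZeroDigit d → NAF (d ∷ ds) → ∃[ h ] value ds ≡ + 2 ℤ.* h
NAF-tail-even {ds = []}       _   _         = + 0 , refl
NAF-tail-even {ds = zer ∷ ds} _   _         = value ds , ℤ.+-identityˡ _
NAF-tail-even {ds = one ∷ ds} d≠0 (sep , _) = ⊥-elim (sep d≠0 tt)
NAF-tail-even {ds = neg ∷ ds} d≠0 (sep , _) = ⊥-elim (sep d≠0 tt)

one∷≢neg∷ : ∀ {ds es} → NAF (one ∷ ds) → NAF (neg ∷ es) → value (one ∷ ds) ≢ value (neg ∷ es)
one∷≢neg∷ {ds} {es} naf₁ naf₂ eq with NAF-tail-even tt naf₁ | NAF-tail-even tt naf₂
... | h , ds≡2h | h′ , es≡2h′ = 2*i≢1+2*j h′ h (ℤ.*-cancelˡ-≡ (+ 2) _ _ (begin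
  + 2 ℤ.* (+ 2 ℤ.* h′)                        ≡⟨ shift (+ 2 ℤ.* h′) ⟩
  (ℤ.- + 1 ℤ.+ + 2 ℤ.* (+ 2 ℤ.* h′)) ℤ.+ + 1  ≡⟨ cong (λ t → (ℤ.- + 1 ℤ.+ + 2 ℤ.* t) ℤ.+ + 1) es≡2h′ ⟨
  value (neg ∷ es) ℤ.+ + 1                    ≡⟨ cong (ℤ._+ + 1) eq ⟨
  value (one ∷ ds) ℤ.+ + 1                    ≡⟨ cong (λ t → (+ 1 ℤ.+ + 2 ℤ.* t) ℤ.+ + 1) ds≡2h ⟩
  (+ 1 ℤ.+ + 2 ℤ.* (+ 2 ℤ.* h)) ℤ.+ + 1       ≡⟨ shift′ h ⟩
  + 2 ℤ.* (+ 1 ℤ.+ + 2 ℤ.* h)                 ∎))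
  where
  open ≡-Reasoning
  shift : ∀ x → + 2 ℤ.* x ≡ (ℤ.- + 1 ℤ.+ + 2 ℤ.* x) ℤ.+ + 1
  shift = ℤ-Solver.solve-∀
  shift′ : ∀ x → (+ 1 ℤ.+ + 2 ℤ.* (+ 2 ℤ.* x)) ℤ.+ + 1 ≡ + 2 ℤ.* (+ 1 ℤ.+ + 2 ℤ.* x)
  shift′ = ℤ-Solver.solve-∀

zer∷≢nonZero∷ : ∀ e → NonZeroDigit e → ∀ ds es → value (zer ∷ ds) ≢ value (e ∷ es)
zer∷≢nonZero∷ e e≠0 ds es eq = nonZero∷-odd e e≠0 es (value ds) (trans (sym eq) (ℤ.+-identityˡ _))

lowestDigit-unique : ∀ {d e ds es} → NAF (d ∷ ds) → NAF (e ∷ es) →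
                     value (d ∷ ds) ≡ value (e ∷ es) → d ≡ e
lowestDigit-unique {one} {one}           _    _    _  = refl
lowestDigit-unique {zer} {zer}           _    _    _  = refl
lowestDigit-unique {neg} {neg}           _    _    _  = refl
lowestDigit-unique {zer} {one} {ds} {es} _    _    eq = ⊥-elim (zer∷≢nonZero∷ one tt ds es eq)
lowestDigit-unique {zer} {neg} {ds} {es} _    _    eq = ⊥-elim (zer∷≢nonZero∷ neg tt ds es eq)
lowestDigit-unique {one} {zer} {ds} {es} _    _    eq = ⊥-elim (zer∷≢nonZero∷ one tt es ds (sym eq))
lowestDigit-unique {neg} {zer} {ds} {es} _    _    eq = ⊥-elim (zer∷≢nonZero∷ neg tt es ds (sym eq))
lowestDigit-unique {one} {neg}           naf₁ naf₂ eq = ⊥-elim (one∷≢neg∷ naf₁ naf₂ eq)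
lowestDigit-unique {neg} {one}           naf₁ naf₂ eq = ⊥-elim (one∷≢neg∷ naf₂ naf₁ (sym eq))

value-∷-injectiveʳ : ∀ d ds es → value (d ∷ ds) ≡ value (d ∷ es) → value ds ≡ value es
value-∷-injectiveʳ d ds es eq = ℤ.*-cancelˡ-≡ (+ 2) _ _ (∙-cancelˡ (digitVal d) _ _ eq)

LeadingNonZero⇒value≢0 : ∀ ds → LeadingNonZero ds → value ds ≢ + 0
LeadingNonZero⇒value≢0 (zer ∷ e ∷ ds) lnz eq =
  LeadingNonZero⇒value≢0 (e ∷ ds) lnz (ℤ.*-cancelˡ-≡ (+ 2) _ (+ 0) (trans (sym (ℤ.+-identityˡ _)) eq))
LeadingNonZero⇒value≢0 (one ∷ ds)     _   = nonZero∷-odd one tt ds (+ 0)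
LeadingNonZero⇒value≢0 (neg ∷ ds)     _   = nonZero∷-odd neg tt ds (+ 0)

reducedNAF-unique : ∀ {ds es} → NAF ds → NAF es → LeadingNonZero ds → LeadingNonZero es →
                    value ds ≡ value es → ds ≡ es
reducedNAF-unique {d ∷ ds} {e ∷ es} naf₁ naf₂ lnz₁ lnz₂ eq with lowestDigit-unique naf₁ naf₂ eq
reducedNAF-unique {_ ∷ []}     {_ ∷ []}      _           _           _    _    _  | refl = refl
reducedNAF-unique {d ∷ []}     {_ ∷ e ∷ es}  _           _           _    lnz₂ eq | refl =
  ⊥-elim (LeadingNonZero⇒value≢0 (e ∷ es) lnz₂ (sym (value-∷-injectiveʳ d [] (e ∷ es) eq)))
reducedNAF-unique {d ∷ e ∷ ds} {_ ∷ []}      _           _           lnz₁ _    eq | refl =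
  ⊥-elim (LeadingNonZero⇒value≢0 (e ∷ ds) lnz₁ (value-∷-injectiveʳ d (e ∷ ds) [] eq))
reducedNAF-unique {d ∷ e ∷ ds} {_ ∷ e′ ∷ es} (_ , naf₁)  (_ , naf₂)  lnz₁ lnz₂ eq | refl =
  cong (d ∷_) (reducedNAF-unique naf₁ naf₂ lnz₁ lnz₂ (value-∷-injectiveʳ d (e ∷ ds) (e′ ∷ es) eq))

reducedNAFOf-unique : ∀ {n ds es} → ReducedNAFOf n ds → ReducedNAFOf n es → ds ≡ es
reducedNAFOf-unique (naf₁ , lnz₁ , v₁) (naf₂ , lnz₂ , v₂) =
  reducedNAF-unique naf₁ naf₂ lnz₁ lnz₂ (trans v₁ (sym v₂))

-- NAFs of prescribed length

-- The value is written p ⊖ q so that all size conditions on it stay in ℕ.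
record NAFOfDiff (L p q : ℕ) (w : List Digit) : Set where
  constructor nafOfDiff
  field
    naf     : NAF w
    length≡ : length w ≡ L
    value≡  : value w ≡ p ⊖ q

NAFOfDiff-resp : ∀ {L p q p′ q′ w} → p ⊖ q ≡ p′ ⊖ q′ → NAFOfDiff L p q w → NAFOfDiff L p′ q′ w
NAFOfDiff-resp eq (nafOfDiff naf len val) = nafOfDiff naf len (trans val eq)

NAFOfDiff-negate : ∀ {L p q w} → NAFOfDiff L p q w → NAFOfDiff L q p (map negate w)
NAFOfDiff-negate {p = p} {q} {w} (nafOfDiff naf len val) = nafOfDiff
  (NAF-negate w naf)
  (trans (length-map negate w) len)
  (trans (value-negate w) (trans (cong ℤ.-_ val) (sym (ℤ.⊖-swap q p))))

NAFOfDiff-++ : ∀ {L p q c w s} → NAFOfDiff L p q w → NAF (zer ∷ s) → value (zer ∷ s) ≡ + c →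
               NAFOfDiff (suc (length s) + L) (p + 2 ^ L * c) q (w ++ zer ∷ s)
NAFOfDiff-++ {L} {p} {q} {c} {w} {s} (nafOfDiff naf len val) nafₛ valₛ = nafOfDiff
  (NAF-++ w s naf nafₛ)
  (trans (length-++ w) (trans (cong (_+ suc (length s)) len) (+-comm L _)))
  (begin
    value (w ++ zer ∷ s)                            ≡⟨ value-++ w (zer ∷ s) ⟩
    value w ℤ.+ + 2 ^ length w ℤ.* value (zer ∷ s)  ≡⟨ cong₂ ℤ._+_ val (cong₂ (λ m t → + 2 ^ m ℤ.* t) len valₛ) ⟩
    p ⊖ q ℤ.+ + 2 ^ L ℤ.* + c                       ≡⟨ cong (ℤ._+_ (p ⊖ q)) (ℤ.pos-* (2 ^ L) c) ⟨
    p ⊖ q ℤ.+ + (2 ^ L * c)                         ≡⟨ ℤ.distribˡ-⊖-+-pos (2 ^ L * c) p q ⟩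
    (p + 2 ^ L * c) ⊖ q                             ∎)
  where open ≡-Reasoning

appendZero : ∀ {L p q w} → NAFOfDiff L p q w → NAFOfDiff (suc L) p q (w ++ zer ∷ [])
appendZero {L} {p} r = subst (λ p′ → NAFOfDiff (suc L) p′ _ _) p+2^L*0≡p (NAFOfDiff-++ r tt refl)
  where
  p+2^L*0≡p : p + 2 ^ L * 0 ≡ p
  p+2^L*0≡p = trans (cong (_+_ p) (*-zeroʳ (2 ^ L))) (+-identityʳ p)

appendZeroOne : ∀ {L p q w} → NAFOfDiff L p (q + 2 ^ suc L) w →
                NAFOfDiff (2 + L) p q (w ++ zer ∷ one ∷ [])
appendZeroOne {L} {p} {q} r = NAFOfDiff-resp shift (NAFOfDiff-++ r ((λ ()) , tt) refl)
  where
  shift : (p + 2 ^ L * 2) ⊖ (q + 2 ^ suc L) ≡ p ⊖ q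
  shift = begin
    (p + 2 ^ L * 2) ⊖ (q + 2 ^ suc L)  ≡⟨ cong₂ _⊖_ (+-comm p _) (+-comm q _) ⟩
    (2 ^ L * 2 + p) ⊖ (2 ^ suc L + q)  ≡⟨ cong (λ t → (t + p) ⊖ (2 ^ suc L + q)) (*-comm (2 ^ L) 2) ⟩
    (2 ^ suc L + p) ⊖ (2 ^ suc L + q)  ≡⟨ ℤ.+-cancelˡ-⊖ (2 ^ suc L) p q ⟩
    p ⊖ q                              ∎
    where open ≡-Reasoning

x+q≡p⇒p⊖q≡x : ∀ {x p q} → x + q ≡ p → p ⊖ q ≡ + x
x+q≡p⇒p⊖q≡x {x} {q = q} refl = begin
  (x + q) ⊖ q       ≡⟨ ℤ.distribʳ-⊖-+-pos x q q ⟨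
  + x ℤ.+ (q ⊖ q)   ≡⟨ cong (ℤ._+_ (+ x)) (ℤ.n⊖n≡0 q) ⟩
  + x ℤ.+ + 0       ≡⟨ ℤ.+-identityʳ (+ x) ⟩
  + x               ∎
  where open ≡-Reasoning

remove-2^[1+L]-bounds : ∀ L p q → a (2 + L) + q ≤ p → p < a (3 + L) + q →
             p < a (suc L) + (q + 2 ^ suc L) × q + 2 ^ suc L < a (suc L) + p
remove-2^[1+L]-bounds L p q a+q≤p p< =
  (begin-strict
    p                                 <⟨ p< ⟩
    (2 ^ suc L + a (suc L)) + q       ≡⟨ rearrange (2 ^ suc L) (a (suc L)) q ⟩
    a (suc L) + (q + 2 ^ suc L)       ∎) ,
  (begin-strict
    q + 2 ^ suc L                     <⟨ +-monoʳ-< q (n<1+n (2 ^ suc L)) ⟩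
    q + suc (2 ^ suc L)               ≡⟨ cong (_+_ q) (a-adjacent L) ⟨
    q + (a (suc L) + a (2 + L))       ≡⟨ rearrange′ q (a (suc L)) (a (2 + L)) ⟩
    a (suc L) + (a (2 + L) + q)       ≤⟨ +-monoʳ-≤ (a (suc L)) a+q≤p ⟩
    a (suc L) + p                     ∎)
  where
  open ≤-Reasoning
  rearrange : ∀ x y z → (x + y) + z ≡ y + (z + x)
  rearrange = ℕ-Solver.solve-∀
  rearrange′ : ∀ x y z → x + (y + z) ≡ y + (z + x)
  rearrange′ = ℕ-Solver.solve-∀

∃NAFOfDiff-swap : ∀ {L p q} → ∃[ w ] NAFOfDiff L q p w → ∃[ w ] NAFOfDiff L p q w
∃NAFOfDiff-swap = Product.map (map negate) NAFOfDiff-negate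

Representable : ℕ → Set
Representable L = ∀ p q → p < a (suc L) + q → q < a (suc L) + p → ∃[ w ] NAFOfDiff L p q w

representable-step : ∀ L → Representable (suc L) → Representable L → Representable (2 + L)
representable-step L rec₁ rec₀ p q p< q< with p <? a (2 + L) + q | q <? a (2 + L) + p
... | yes p<′ | yes q<′ = Product.map (_++ zer ∷ []) (appendZero {p = p} {q}) (rec₁ p q p<′ q<′)
... | no p≮   | _       = Product.map (_++ zer ∷ one ∷ []) (appendZeroOne {p = p} {q})
  (Product.uncurry (rec₀ p (q + 2 ^ suc L)) (remove-2^[1+L]-bounds L p q (≮⇒≥ p≮) p<))
... | yes _   | no q≮   = ∃NAFOfDiff-swap {p = p} {q}
  (Product.map (_++ zer ∷ one ∷ []) (appendZeroOne {p = q} {p})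
    (Product.uncurry (rec₀ q (p + 2 ^ suc L)) (remove-2^[1+L]-bounds L q p (≮⇒≥ q≮) q<)))

representable : ∀ L → Representable L
representable zero p q p< q< with ≤-antisym (s≤s⁻¹ p<) (s≤s⁻¹ q<)
... | refl = [] , nafOfDiff tt refl (sym (ℤ.n⊖n≡0 p))
representable (suc zero) p q p< q< with <-cmp p q
... | tri≈ _ refl _ = zer ∷ [] , nafOfDiff tt refl (sym (ℤ.n⊖n≡0 p))
... | tri< p<q _ _ with ≤-antisym (s≤s⁻¹ q<) p<q
...   | refl = ∃NAFOfDiff-swap (one ∷ [] , nafOfDiff tt refl (sym (x+q≡p⇒p⊖q≡x {1} {suc p} {p} refl)))
representable (suc zero) p q p< q< | tri> _ _ q<p with ≤-antisym (s≤s⁻¹ p<) q<p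
...   | refl = one ∷ [] , nafOfDiff tt refl (sym (x+q≡p⇒p⊖q≡x {1} {suc q} {q} refl))
representable (suc (suc L)) = representable-step L (representable (suc L)) (representable L)

-- Reduced NAFs of the four families of numbers

k+p≡m⇒m∸[k+n]+n≡p : ∀ k {p} n {m} → k + p ≡ m → n ≤ p → m ∸ (k + n) + n ≡ p
k+p≡m⇒m∸[k+n]+n≡p k {p} n refl n≤p = trans (cong (_+ n) ([m+n]∸[m+o]≡n∸o k p n)) (m∸n+n≡m n≤p)

reducedNAF-++ : ∀ {L p q c x w} s → NAFOfDiff L p q w → NAF (zer ∷ s) → LeadingNonZero (zer ∷ s) →
                value (zer ∷ s) ≡ + c → x + q ≡ p + 2 ^ L * c → ReducedNAFOf x (w ++ zer ∷ s)
reducedNAF-++ {w = w} s r nafₛ lnzₛ valₛ eq =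
  naf , LeadingNonZero-++ w lnzₛ , trans value≡ (x+q≡p⇒p⊖q≡x eq)
  where open NAFOfDiff (NAFOfDiff-++ r nafₛ valₛ)

zeros-++-suc : ∀ w w′ {s s′} → zeros w ≡ zeros w′ → zeros s ≡ suc (zeros s′) →
               zeros (w ++ s) ≡ suc (zeros (w′ ++ s′))
zeros-++-suc w w′ {s} {s′} zw zs = begin
  zeros (w ++ s)              ≡⟨ zeros-++ w s ⟩
  zeros w + zeros s           ≡⟨ cong₂ _+_ zw zs ⟩
  zeros w′ + suc (zeros s′)   ≡⟨ +-suc (zeros w′) (zeros s′) ⟩
  suc (zeros w′ + zeros s′)   ≡⟨ cong suc (zeros-++ w′ s′) ⟨
  suc (zeros (w′ ++ s′))      ∎
  where open ≡-Reasoning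

ZSucRel-intro : ∀ {x y ds es} → ReducedNAFOf x ds → ReducedNAFOf y es →
                zeros ds ≡ suc (zeros es) → ZSucRel x y
ZSucRel-intro rx ry z ds es rds res rewrite reducedNAFOf-unique rds rx | reducedNAFOf-unique res ry = z

lowDigits : ∀ L n → a (2 + L) ≤ n → n < a (3 + L) → ∃[ w ] NAFOfDiff L n (2 ^ suc L) w
lowDigits L n a≤n n<a = Product.uncurry (representable L n (2 ^ suc L))
  (remove-2^[1+L]-bounds L n 0 (subst (_≤ n) (sym (+-identityʳ _)) a≤n)
                                (subst (n <_) (sym (+-identityʳ _)) n<a))

module _ (L : ℕ) {n : ℕ} (a≤n : a (2 + L) ≤ n) (n<a : n < a (3 + L)) where
  private
    P = 2 ^ L
    w = proj₁ (lowDigits L n a≤n n<a)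
    r = proj₂ (lowDigits L n a≤n n<a)
    r⁻ = NAFOfDiff-negate r
    n≤4P : n ≤ 2 ^ (2 + L)
    n≤4P = <⇒≤ (≤-trans n<a (a≤2^ (2 + L)))
    n-as-01 : ReducedNAFOf n (w ++ zer ∷ one ∷ [])
    n-as-01 = reducedNAF-++ (one ∷ []) r ((λ ()) , tt) tt refl (cong (_+_ n) (*-comm 2 P))

  ZSucRel-2^[1+L]+n : ZSucRel (2 ^ suc L + n) n
  ZSucRel-2^[1+L]+n = ZSucRel-intro x-as-001 n-as-01 (zeros-++-suc w w refl refl)
    where
    shift : ∀ P n → (2 * P + n) + 2 * P ≡ n + P * 4
    shift = ℕ-Solver.solve-∀
    x-as-001 : ReducedNAFOf (2 ^ suc L + n) (w ++ zer ∷ zer ∷ one ∷ [])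
    x-as-001 = reducedNAF-++ (zer ∷ one ∷ []) r ((λ ()) , (λ ()) , tt) tt refl (shift P n)

  ZSucRel-2^[2+L]+n : ZSucRel (2 ^ (2 + L) + n) n
  ZSucRel-2^[2+L]+n = ZSucRel-intro x-as-0-101 n-as-01 (zeros-++-suc w w refl refl)
    where
    shift : ∀ P n → (2 * (2 * P) + n) + 2 * P ≡ n + P * 6
    shift = ℕ-Solver.solve-∀
    x-as-0-101 : ReducedNAFOf (2 ^ (2 + L) + n) (w ++ zer ∷ neg ∷ zer ∷ one ∷ [])
    x-as-0-101 = reducedNAF-++ (neg ∷ zer ∷ one ∷ []) r ((λ ()) , (λ _ ()) , (λ ()) , tt) tt refl
      (shift P n)

  ZSucRel-2^[3+L]∸[2^[1+L]+n] : ZSucRel (2 ^ (3 + L) ∸ (2 ^ suc L + n)) n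
  ZSucRel-2^[3+L]∸[2^[1+L]+n] =
    ZSucRel-intro x-as-001 n-as-01 (zeros-++-suc (map negate w) w (zeros-negate w) refl)
    where
    shift : ∀ P → 2 * P + (2 * P + P * 4) ≡ 2 * (2 * (2 * P))
    shift = ℕ-Solver.solve-∀
    4P≡P*4 : ∀ P → 2 * (2 * P) ≡ P * 4
    4P≡P*4 = ℕ-Solver.solve-∀
    n≤6P : n ≤ 2 ^ suc L + P * 4
    n≤6P = ≤-trans n≤4P (≤-trans (≤-reflexive (4P≡P*4 P)) (m≤n+m (P * 4) (2 ^ suc L)))
    x-as-001 : ReducedNAFOf (2 ^ (3 + L) ∸ (2 ^ suc L + n)) (map negate w ++ zer ∷ zer ∷ one ∷ [])
    x-as-001 = reducedNAF-++ (zer ∷ one ∷ []) r⁻ ((λ ()) , (λ ()) , tt) tt refl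
      (k+p≡m⇒m∸[k+n]+n≡p (2 ^ suc L) n (shift P) n≤6P)

  ZSucRel-2^[3+L]+n : ZSucRel (2 ^ (3 + L) + n) (2 ^ (2 + L) ∸ n)
  ZSucRel-2^[3+L]+n =
    ZSucRel-intro x-as-0101 y-as-01 (zeros-++-suc w (map negate w) (sym (zeros-negate w)) refl)
    where
    shift : ∀ P n → (2 * (2 * (2 * P)) + n) + 2 * P ≡ n + P * 10
    shift = ℕ-Solver.solve-∀
    shift′ : ∀ P → 2 * P + P * 2 ≡ 2 * (2 * P)
    shift′ = ℕ-Solver.solve-∀
    x-as-0101 : ReducedNAFOf (2 ^ (3 + L) + n) (w ++ zer ∷ one ∷ zer ∷ one ∷ [])
    x-as-0101 = reducedNAF-++ (one ∷ zer ∷ one ∷ []) r ((λ ()) , (λ _ ()) , (λ ()) , tt) tt refl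
      (shift P n)
    y-as-01 : ReducedNAFOf (2 ^ (2 + L) ∸ n) (map negate w ++ zer ∷ one ∷ [])
    y-as-01 = reducedNAF-++ (one ∷ []) r⁻ ((λ ()) , tt) tt refl
      (k+p≡m⇒m∸[k+n]+n≡p 0 n (shift′ P) (subst (n ≤_) (sym (shift′ P)) n≤4P))

v<sizeI⇒a+v<a : ∀ L v → v < sizeI (suc L) → a (suc L) + v < a (2 + L)
v<sizeI⇒a+v<a L v v< = begin-strict
  a (suc L) + v           <⟨ +-monoʳ-< (a (suc L)) v< ⟩
  a (suc L) + sizeI (suc L) ≡⟨ +-comm (a (suc L)) _ ⟩
  sizeI (suc L) + a (suc L) ≡⟨ sizeI+a L ⟩
  a (2 + L)               ∎
  where open ≤-Reasoning

ZSucRel-a+v : ∀ L v → v < sizeI (suc L) → ZSucRel (a (3 + L) + v) (a (suc L) + v)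
ZSucRel-a+v zero    zero _  = ZSucRel-intro {ds = neg ∷ zer ∷ one ∷ []} {es = one ∷ []}
  (((λ _ ()) , (λ ()) , tt) , tt , refl) (tt , tt , refl) refl
ZSucRel-a+v zero    (suc v) (s≤s ())
ZSucRel-a+v (suc L) v    v< =
  subst (λ x → ZSucRel x (a (2 + L) + v)) (sym (+-assoc (2 ^ (2 + L)) (a (2 + L)) v))
    (ZSucRel-2^[2+L]+n L (m≤m+n (a (2 + L)) v) (v<sizeI⇒a+v<a (suc L) v v<))

ZSucRel-c+v : ∀ L v → v < sizeI (suc L) → ZSucRel (c (3 + L) + v) (2 ^ suc L ∸ (a (suc L) + v))
ZSucRel-c+v zero    zero _  = ZSucRel-intro {ds = one ∷ zer ∷ one ∷ []} {es = one ∷ []}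
  (((λ _ ()) , (λ ()) , tt) , tt , refl) (tt , tt , refl) refl
ZSucRel-c+v zero    (suc v) (s≤s ())
ZSucRel-c+v (suc L) v    v< = subst (λ x → ZSucRel x (2 ^ (2 + L) ∸ (a (2 + L) + v))) c+v≡
  (ZSucRel-2^[3+L]+n L (m≤m+n (a (2 + L)) v) (v<sizeI⇒a+v<a (suc L) v v<))
  where
  c+v≡ : 2 ^ (3 + L) + (a (2 + L) + v) ≡ c (4 + L) + v
  c+v≡ = trans (sym (+-assoc (2 ^ (3 + L)) (a (2 + L)) v)) (cong (_+ v) (sym (c-closed (suc L))))

b+u≡ : ∀ L u → 2 ^ suc L + (a (2 + L) + u) ≡ b (3 + L) + u
b+u≡ L u = trans (sym (+-assoc (2 ^ suc L) (a (2 + L)) u)) (cong (_+ u) (sym (b-closed L)))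

ZSucRel-b+u : ∀ L u → u ≤ 2 ^ (2 + L) ∸ b (3 + L) → ZSucRel (b (3 + L) + u) (a (2 + L) + u)
ZSucRel-b+u L u u≤ = subst (λ x → ZSucRel x (a (2 + L) + u)) (b+u≡ L u)
  (ZSucRel-2^[1+L]+n L (m≤m+n (a (2 + L)) u) (u≤2^∸b⇒a+u<a L u u≤))

ZSucRel-2^∸[b+u] : ∀ L u → u ≤ 2 ^ (2 + L) ∸ b (3 + L) →
                   ZSucRel (2 ^ (3 + L) ∸ (b (3 + L) + u)) (a (2 + L) + u)
ZSucRel-2^∸[b+u] L u u≤ = subst (λ x → ZSucRel (2 ^ (3 + L) ∸ x) (a (2 + L) + u)) (b+u≡ L u)
  (ZSucRel-2^[3+L]∸[2^[1+L]+n] L (m≤m+n (a (2 + L)) u) (u≤2^∸b⇒a+u<a L u u≤))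

mainTheorem4 : ∀ (k v u : ℕ) → 3 ≤ k → v < sizeI (k ∸ 2) → u ≤ 2 ^ (k ∸ 1) ∸ b k →
    ZSucRel (a k + v) (a (k ∸ 2) + v)
    × ZSucRel (b k + u) (a (k ∸ 1) + u)
    × ZSucRel (2 ^ k ∸ (b k + u)) (a (k ∸ 1) + u)
    × ZSucRel (c k + v) (2 ^ (k ∸ 2) ∸ (a (k ∸ 2) + v))
mainTheorem4 (suc (suc (suc L))) v u (s≤s (s≤s (s≤s _))) v< u≤ =
  ZSucRel-a+v L v v< , ZSucRel-b+u L u u≤ , ZSucRel-2^∸[b+u] L u u≤ , ZSucRel-c+v L v v<
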